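{- Let $P$ and $P'$ be two Eulerian binomial posets with atom functions $A(n)$ and $A'(n)$ such that $A(n)=A'(n)$ for all $n \leq 2m$, where $m \geq 2$. Then $$\frac{1}{A(2m+1)}\left(1-\frac{1}{A(2m+2)}\right) = \frac{1}{A'(2m+1)}\left(1-\frac{1}{A'(2m+2)}\right).$$
   Context: All posets are locally finite with a unique minimal element $\hat 0$. A binomial poset is such a poset that contains an infinite chain, has every interval graded (rank function $\rho$; $[x,y]$ is an $n$-interval if $\rho(y)-\rho(x)=n$), and for every $n$ any two $n$-intervals have the same number $B(n)$ of maximal chains. The atom function is $A(n) = B(n)/B(n-1)$ for $n\ge1$. A poset is Eulerian if $\mu(x,y)=(-1)^{\rho(y)-\rho(x)}$ for all $x\le y$. -}

module Defs where

open import Data.Nat using (ℕ; zero; suc; _∸_; _*_; _+_)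
import Data.Integer as ℤ
open ℤ using (ℤ; +_)
import Data.Rational as ℚ
open ℚ using (ℚ; 0ℚ; 1ℚ; _-_; _÷_)
open import Data.Rational.Properties using () renaming (_≟_ to _≟ℚ_)
open import Data.Fin using (Fin)
open import Data.List using (List; []; _∷_; map; foldr)
open import Data.List.Membership.Propositional using (_∈_)
open import Data.List.Relation.Unary.Unique.Propositional using (Unique)
open import Data.Product using (Σ; _×_; ∃)
open import Data.Empty using (⊥)
open import Function.Definitions using (Injective)
open import Relation.Binary.PropositionalEquality using (_≡_; _≢_)
open import Relation.Binary.Structures using (IsPartialOrder)
open import Relation.Nullary using (¬_; yes; no)

-- "P holds of exactly k elements" of a type with propositional equality:
-- an injective enumeration Fin k → A hitting exactly the elements satisfying P.
record HasCount {A : Set} (P : A → Set) (k : ℕ) : Set where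
  field
    enum      : Fin k → A
    enum-inj  : Injective _≡_ _≡_ enum
    enum-sat  : ∀ i → P (enum i)
    enum-surj : ∀ a → P a → ∃ λ i → enum i ≡ a

sumℤ : List ℤ → ℤ
sumℤ = foldr ℤ._+_ (+ 0)

signℤ : ℕ → ℤ
signℤ zero = + 1
signℤ (suc n) = ℤ.- signℤ n

MaxChainOf : {C : Set} → (C → C → Set) → C → C → List C → Set
MaxChainOf _⋖_ x y [] = ⊥
MaxChainOf _⋖_ x y (z ∷ []) = z ≡ x × z ≡ y
MaxChainOf _⋖_ x y (z ∷ w ∷ l) = z ≡ x × z ⋖ w × MaxChainOf _⋖_ w y (w ∷ l)

record BinomialPoset : Set₁ where
  field
    C   : Set
    _≼_ : C → C → Set
    isPartialOrder : IsPartialOrder _≡_ _≼_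
    bot     : C
    bot-min : ∀ x → bot ≼ x
    -- local finiteness: each interval [x,y] is enumerated by a duplicate-free list
    interval        : C → C → List C
    interval-sound  : ∀ {x y z} → z ∈ interval x y → (x ≼ z × z ≼ y)
    interval-compl  : ∀ {x y z} → x ≼ z → z ≼ y → z ∈ interval x y
    interval-unique : ∀ x y → Unique (interval x y)

  _≺_ : C → C → Set
  x ≺ y = x ≼ y × x ≢ y

  _⋖_ : C → C → Set
  x ⋖ y = x ≺ y × (∀ z → ¬ (x ≺ z × z ≺ y))

  field
    ρ       : C → ℕ
    ρ-bot   : ρ bot ≡ 0
    ρ-cover : ∀ {x y} → x ⋖ y → ρ y ≡ suc (ρ x)
    chain        : ℕ → C
    chain-strict : ∀ i → chain i ≺ chain (suc i)

  field
    B       : ℕ → ℕ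
    B-count : ∀ {x y} → x ≼ y → HasCount (MaxChainOf _⋖_ x y) (B (ρ y ∸ ρ x))

  IsMobius : (C → C → ℤ) → Set
  IsMobius μ = (∀ x → μ x x ≡ + 1)
             × (∀ x y → x ≺ y → sumℤ (map (μ x) (interval x y)) ≡ + 0)

open BinomialPoset public

Eulerian : BinomialPoset → Set
Eulerian P = Σ (C P → C P → ℤ) λ μ → IsMobius P μ
  × (∀ x y → _≼_ P x y → μ x y ≡ signℤ (ρ P y ∸ ρ P x))

-- total division on ℚ (value 0 when dividing by 0; never used with 0 here,
-- since B n ≥ 1 for binomial posets)
divℚ : ℚ → ℚ → ℚ
divℚ p q with q ≟ℚ 0ℚ
... | yes _ = 0ℚ
... | no q≢0 = _÷_ p q {{ℚ.≢-nonZero q≢0}}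

atom : BinomialPoset → ℕ → ℚ
atom P n = divℚ ((+ B P n ℚ./ 1)) ((+ B P (n ∸ 1) ℚ./ 1))

quantity : BinomialPoset → ℕ → ℚ
quantity P m = divℚ 1ℚ (atom P (suc (2 * m)))
  ℚ.* (1ℚ - divℚ 1ℚ (atom P (suc (suc (2 * m)))))

-- In an n-interval of a binomial poset the elements of rank k cut every maximal chain in two,
-- so there are B(n) / (B(k) B(n - k)) of them, and in an Eulerian poset their alternating sum
-- vanishes: Σₖ (-1)^k / (B(k) B(n - k)) = 0. For n = 2m + 2 the terms k = 0, 1, n - 1, n add up
-- to -2 (1/B(2m+1) - 1/B(2m+2)), while the others only involve B(2), …, B(2m), which are
-- determined by A(1), …, A(2m). Finally the quantity equals B(2m) (1/B(2m+1) - 1/B(2m+2)).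

module Submission where

open import Defs
  using (BinomialPoset; MaxChainOf; HasCount; Eulerian; signℤ; sumℤ; divℚ; atom; quantity)

open import Data.Nat
  using (ℕ; zero; suc; _+_; _*_; _∸_; _≤_; _<_; z≤n; s≤s; _≟_)
open import Data.Nat.Properties
open import Data.Fin using (Fin; zero; suc)
open import Data.Fin.Properties using (*↔×; injective⇒≤)
open import Data.List using (List; []; _∷_; length; lookup; _++_; drop; filter; map)
open import Data.List.Properties using (∷-injective; map-cong-local)
open import Data.List.Membership.Propositional using (_∈_)
open import Data.List.Membership.Propositional.Properties using (∈-lookup; ∈-filter⁺; ∈-filter⁻)
open import Data.List.Relation.Unary.Any using (index)
open import Data.List.Relation.Unary.Any.Properties using (lookup-index)
open import Data.List.Relation.Unary.All as All using (All; []; _∷_)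
open import Data.List.Relation.Unary.AllPairs using ([]; _∷_)
open import Data.List.Relation.Unary.Unique.Propositional using (Unique)
open import Data.List.Relation.Unary.Unique.Propositional.Properties using (filter⁺)
open import Data.Product using (_×_; _,_; proj₁; proj₂; ∃; map₁)
open import Data.Product.Function.NonDependent.Propositional using (_×-↔_)
open import Data.Bool using (if_then_else_; true; false)
open import Data.Empty using (⊥-elim)
import Data.Integer as ℤ
open ℤ using (ℤ; +_)
import Data.Integer.Properties as ℤ
import Algebra.Properties.CommutativeSemigroup ℤ.+-commutativeSemigroup as ℤ+
import Data.Rational as ℚ
open ℚ using (ℚ; 0ℚ; 1ℚ; _-_; -_)
import Data.Rational.Properties as ℚ
open import Data.Rational.Solver using (module +-*-Solver)
open +-*-Solver using (solve; _:=_; _:+_; _:*_; _:-_; :-_; con)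
import Data.Rational.Unnormalised as ℚᵘ
import Data.Rational.Unnormalised.Properties as ℚᵘ
open import Effect.Monad using (RawMonad)
open import Function using (_∘_; id; case_of_)
open import Function.Bundles using (_↔_; Inverse; Injection)
open import Function.Definitions using (Injective)
open import Function.Properties.Inverse using (↔-refl; ↔-trans; ↔⇒↣)
open import Level using (0ℓ)
open import Relation.Binary.PropositionalEquality
  using (_≡_; _≢_; refl; sym; trans; cong; cong₂; subst; module ≡-Reasoning)
open import Relation.Binary.Structures using (IsPartialOrder)
open import Relation.Nullary using (¬_; Dec; yes; no; does)
open import Relation.Nullary.Decidable using (decidable-stable; ¬¬-excluded-middle; dec-true; dec-false)
open import Relation.Nullary.Negation using (¬¬-Monad; DoubleNegation)

open RawMonad (¬¬-Monad {a = 0ℓ})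
open HasCount

-- Counting

module _ {A : Set} where

  hasCount-≤ : ∀ {P Q : A → Set} {m n} → (∀ {a} → P a → Q a) →
               HasCount P m → HasCount Q n → m ≤ n
  hasCount-≤ P⊆Q H K = injective⇒≤ {f = f} f-injective
    where
    f : Fin _ → Fin _
    f i = proj₁ (enum-surj K (enum H i) (P⊆Q (enum-sat H i)))
    f-injective : Injective _≡_ _≡_ f
    f-injective {i} {j} fi≡fj = enum-inj H (begin
      enum H i                                                ≡⟨ proj₂ (enum-surj K _ _) ⟨
      enum K (f i)                                            ≡⟨ cong (enum K) fi≡fj ⟩
      enum K (f j)                                            ≡⟨ proj₂ (enum-surj K _ _) ⟩
      enum H j                                                ∎)
      where open ≡-Reasoning

  hasCount-unique : ∀ {P : A → Set} {m n} → HasCount P m → HasCount P n → m ≡ n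
  hasCount-unique H K = ≤-antisym (hasCount-≤ id H K) (hasCount-≤ id K H)

  hasCount-nonzero : ∀ {P : A → Set} {n a} → HasCount P n → P a → n ≢ 0
  hasCount-nonzero H Pa refl with enum-surj H _ Pa
  ... | () , _

  hasCount-singleton : ∀ {P : A → Set} {a} → P a → (∀ b → P b → b ≡ a) → HasCount P 1
  hasCount-singleton {a = a} Pa unique = record
    { enum      = λ _ → a
    ; enum-inj  = λ { {zero} {zero} _ → refl }
    ; enum-sat  = λ _ → Pa
    ; enum-surj = λ b Pb → zero , sym (unique b Pb)
    }

  hasCount-fromDecoding : ∀ {P : A → Set} {X : Set} {m} (e : Fin m ↔ X) (decode : X → A) →
                 Injective _≡_ _≡_ decode → (∀ x → P (decode x)) →
                 (∀ a → P a → ∃ λ x → decode x ≡ a) → HasCount P m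
  hasCount-fromDecoding e decode decode-inj decode-sat decode-surj = record
    { enum      = decode ∘ to
    ; enum-inj  = Injection.injective (↔⇒↣ e) ∘ decode-inj
    ; enum-sat  = decode-sat ∘ to
    ; enum-surj = λ a Pa → let (x , eq) = decode-surj a Pa in
                           from x , trans (cong decode (strictlyInverseˡ x)) eq
    }
    where open Inverse e

  lookup-injective : ∀ {L : List A} → Unique L → ∀ i j → lookup L i ≡ lookup L j → i ≡ j
  lookup-injective (_ ∷ _)    zero    zero    _  = refl
  lookup-injective (x∉ ∷ _)   zero    (suc j) eq = ⊥-elim (All.lookup x∉ (∈-lookup j) eq)
  lookup-injective (x∉ ∷ _)   (suc i) zero    eq = ⊥-elim (All.lookup x∉ (∈-lookup i) (sym eq))
  lookup-injective (_ ∷ uniq) (suc i) (suc j) eq = cong suc (lookup-injective uniq i j eq)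

  unique⇒hasCount : ∀ {L : List A} → Unique L → HasCount (_∈ L) (length L)
  unique⇒hasCount {L} uniq = record
    { enum      = lookup L
    ; enum-inj  = lookup-injective uniq _ _
    ; enum-sat  = ∈-lookup
    ; enum-surj = λ a a∈L → index a∈L , sym (lookup-index a∈L)
    }

  ++-injective : ∀ (xs xs′ : List A) {ys ys′} → length xs ≡ length xs′ →
                 xs ++ ys ≡ xs′ ++ ys′ → xs ≡ xs′ × ys ≡ ys′
  ++-injective []       []         _   eq = refl , eq
  ++-injective (x ∷ xs) (x′ ∷ xs′) len eq with ∷-injective eq
  ... | refl , eq′ = map₁ (cong (x ∷_)) (++-injective xs xs′ (suc-injective len) eq′)

-- Sums over initial segments of ℕ

Σℤ : (ℕ → ℤ) → ℕ → ℤ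
Σℤ h zero    = + 0
Σℤ h (suc N) = Σℤ h N ℤ.+ h N

Σℤ-cong : ∀ {h h′} N → (∀ k → k < N → h k ≡ h′ k) → Σℤ h N ≡ Σℤ h′ N
Σℤ-cong zero    _  = refl
Σℤ-cong (suc N) eq = cong₂ ℤ._+_ (Σℤ-cong N λ k k<N → eq k (m≤n⇒m≤1+n k<N)) (eq N ≤-refl)

Σℤ-zero : ∀ {h} N → (∀ k → k < N → h k ≡ + 0) → Σℤ h N ≡ + 0
Σℤ-zero zero    _   = refl
Σℤ-zero (suc N) h≡0 = cong₂ ℤ._+_ (Σℤ-zero N λ k k<N → h≡0 k (m≤n⇒m≤1+n k<N)) (h≡0 N ≤-refl)

Σℤ-+ : ∀ h h′ N → Σℤ (λ k → h k ℤ.+ h′ k) N ≡ Σℤ h N ℤ.+ Σℤ h′ N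
Σℤ-+ h h′ zero    = refl
Σℤ-+ h h′ (suc N) = trans (cong (ℤ._+ (h N ℤ.+ h′ N)) (Σℤ-+ h h′ N))
                          (ℤ+.interchange (Σℤ h N) (Σℤ h′ N) (h N) (h′ N))

indicator : ℕ → ℕ → ℕ
indicator a k = if does (a ≟ k) then 1 else 0

Σℤ-indicator : ∀ (g : ℕ → ℤ) a N → a < N → Σℤ (λ k → g k ℤ.* + indicator a k) N ≡ g a
Σℤ-indicator g a (suc N) a<1+N with a ≟ N
... | yes refl rewrite dec-true (a ≟ a) refl =
  trans (cong₂ ℤ._+_ (Σℤ-zero {λ k → g k ℤ.* + indicator a k} a off-diagonal) (ℤ.*-identityʳ (g a)))
        (ℤ.+-identityˡ (g a))
  where
  off-diagonal : ∀ k → k < a → g k ℤ.* + indicator a k ≡ + 0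
  off-diagonal k k<a rewrite dec-false (a ≟ k) (λ { refl → <-irrefl refl k<a }) = ℤ.*-zeroʳ (g k)
... | no a≢N rewrite dec-false (a ≟ N) a≢N =
  trans (cong₂ ℤ._+_ (Σℤ-indicator g a N (≤∧≢⇒< (≤-pred a<1+N) a≢N)) (ℤ.*-zeroʳ (g N)))
        (ℤ.+-identityʳ (g a))

module _ {A : Set} (f : A → ℕ) where

  level : ℕ → List A → List A
  level k = filter (λ z → f z ≟ k)

  level-length-∷ : ∀ z L k → + length (level k (z ∷ L)) ≡ + indicator (f z) k ℤ.+ + length (level k L)
  level-length-∷ z L k with does (f z ≟ k)
  ... | true  = refl
  ... | false = refl

  sumℤ-by-level : ∀ (g : ℕ → ℤ) N L → All (λ z → f z < N) L →
                  sumℤ (map (g ∘ f) L) ≡ Σℤ (λ k → g k ℤ.* + length (level k L)) N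
  sumℤ-by-level g N []      _            = sym (Σℤ-zero N λ k _ → ℤ.*-zeroʳ (g k))
  sumℤ-by-level g N (z ∷ L) (fz<N ∷ f<N) = sym (begin
    Σℤ (λ k → g k ℤ.* + length (level k (z ∷ L))) N
      ≡⟨ Σℤ-cong N (λ k _ → trans (cong (g k ℤ.*_) (level-length-∷ z L k)) (ℤ.*-distribˡ-+ (g k) _ _)) ⟩
    Σℤ (λ k → g k ℤ.* + indicator (f z) k ℤ.+ g k ℤ.* + length (level k L)) N
      ≡⟨ Σℤ-+ _ _ N ⟩
    Σℤ (λ k → g k ℤ.* + indicator (f z) k) N ℤ.+ Σℤ (λ k → g k ℤ.* + length (level k L)) N
      ≡⟨ cong₂ ℤ._+_ (Σℤ-indicator g (f z) N fz<N) (sym (sumℤ-by-level g N L f<N)) ⟩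
    g (f z) ℤ.+ sumℤ (map (g ∘ f) L) ∎)
    where open ≡-Reasoning

-- Chains

-- MaxChainOf R x y l only says that consecutive entries of l are R-related; it describes
-- maximal chains for R = _⋖_ and strict chains for R = _≺_.

record ChainSplit {C : Set} (R : C → C → Set) (x y : C) (k : ℕ) (c : List C) : Set where
  constructor split
  field
    {mid}         : C
    {prefix}      : List C
    {suffix}      : List C
    prefix-chain  : MaxChainOf R x mid prefix
    suffix-chain  : MaxChainOf R mid y (mid ∷ suffix)
    prefix-length : length prefix ≡ suc k
    concat        : c ≡ prefix ++ suffix

module _ {C : Set} {R : C → C → Set} where

  chain-head : ∀ {x y l} → MaxChainOf R x y l → ∃ λ r → l ≡ x ∷ r
  chain-head {l = _ ∷ []}    (refl , _) = [] , refl
  chain-head {l = _ ∷ w ∷ l} (refl , _) = w ∷ l , refl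

  chain-uncons : ∀ {x y l} → MaxChainOf R x y l → l ≡ x ∷ drop 1 l
  chain-uncons c with chain-head c
  ... | _ , refl = refl

  chain-map : ∀ {R′ : C → C → Set} → (∀ {a b} → R a b → R′ a b) →
              ∀ {x y l} → MaxChainOf R x y l → MaxChainOf R′ x y l
  chain-map f {l = _ ∷ []}    c                = c
  chain-map f {l = _ ∷ _ ∷ _} (refl , r , c) = refl , f r , chain-map f c

  chain-last : ∀ {x y y′ l} → MaxChainOf R x y l → MaxChainOf R x y′ l → y ≡ y′
  chain-last {l = _ ∷ []}    (refl , refl) (_ , refl) = refl
  chain-last {l = _ ∷ _ ∷ _} (refl , _ , c) (_ , _ , c′) = chain-last c c′

  chain-++ : ∀ {x y z l r} → MaxChainOf R x z l → MaxChainOf R z y (z ∷ r) →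
             MaxChainOf R x y (l ++ r)
  chain-++ {l = _ ∷ []}    (refl , refl) c′ = c′
  chain-++ {l = _ ∷ _ ∷ _} (refl , r , c) c′ = refl , r , chain-++ c c′

  chain-split : ∀ k {x y c} → MaxChainOf R x y c → k < length c → ChainSplit R x y k c
  chain-split zero {c = _ ∷ r} c _ with chain-head c
  ... | _ , refl = split (refl , refl) c refl refl
  chain-split (suc k) {x} {c = _ ∷ w ∷ l} (refl , r , c) (s≤s k<) with chain-split k c k<
  ... | split pc sc len eq with chain-head pc
  ...   | _ , refl = split (refl , r , pc) sc (cong suc len) (cong (x ∷_) eq)

¬¬-greatest : (E : ℕ → Set) (N : ℕ) → (∀ j → E j → j ≤ N) → ∀ {a} → E a →
              DoubleNegation (∃ λ k → E k × ∀ j → E j → j ≤ k)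
¬¬-greatest E zero    bounded {a} Ea = pure (a , Ea , λ j Ej → ≤-trans (bounded j Ej) z≤n)
¬¬-greatest E (suc N) bounded     Ea = ¬¬-excluded-middle >>= λ where
  (yes EN) → pure (suc N , EN , bounded)
  (no ¬EN) → ¬¬-greatest E N (λ j Ej → ≤-pred (≤∧≢⇒< (bounded j Ej) λ { refl → ¬EN Ej })) Ea

module Chains (P : BinomialPoset) where

  open BinomialPoset P
  open IsPartialOrder isPartialOrder
    using () renaming (refl to ≼-refl; trans to ≼-trans; antisym to ≼-antisym)

  StrictChain MaxChain : C → C → List C → Set
  StrictChain = MaxChainOf _≺_
  MaxChain    = MaxChainOf _⋖_

  ≺-≼-trans : ∀ {a b c} → a ≺ b → b ≼ c → a ≺ c
  ≺-≼-trans (a≼b , a≢b) b≼c = ≼-trans a≼b b≼c , λ { refl → a≢b (≼-antisym a≼b b≼c) }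

  maxChain⇒strictChain : ∀ {x y l} → MaxChain x y l → StrictChain x y l
  maxChain⇒strictChain = chain-map proj₁

  strictChain-≼ : ∀ {x y l} → StrictChain x y l → x ≼ y
  strictChain-≼ {l = _ ∷ []}    (refl , refl)  = ≼-refl
  strictChain-≼ {l = _ ∷ _ ∷ _} (refl , r , c) = ≼-trans (proj₁ r) (strictChain-≼ c)

  maxChain-≼ : ∀ {x y l} → MaxChain x y l → x ≼ y
  maxChain-≼ = strictChain-≼ ∘ maxChain⇒strictChain

  strictChain-within : ∀ {x y l} → StrictChain x y l → All (λ z → x ≼ z × z ≼ y) l
  strictChain-within {l = _ ∷ []}    (refl , refl)  = (≼-refl , ≼-refl) ∷ []
  strictChain-within {l = _ ∷ _ ∷ _} (refl , r , c) =
    (≼-refl , ≼-trans (proj₁ r) (strictChain-≼ c)) ∷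
    All.map (map₁ (≼-trans (proj₁ r))) (strictChain-within c)

  strictChain-unique : ∀ {x y l} → StrictChain x y l → Unique l
  strictChain-unique {l = _ ∷ []}    _              = [] ∷ []
  strictChain-unique {l = _ ∷ _ ∷ _} (refl , r , c) =
    All.map (λ (w≼z , _) → proj₂ (≺-≼-trans r w≼z)) (strictChain-within c) ∷ strictChain-unique c

  strictChain-length≤ : ∀ {x y l} → StrictChain x y l → length l ≤ length (interval x y)
  strictChain-length≤ c =
    hasCount-≤ (λ z∈l → let (x≼z , z≼y) = All.lookup (strictChain-within c) z∈l in interval-compl x≼z z≼y)
      (unique⇒hasCount (strictChain-unique c)) (unique⇒hasCount (interval-unique _ _))

  longest-strictChain⇒maxChain : ∀ {x y l} → StrictChain x y l →
    (∀ l′ → StrictChain x y l′ → length l′ ≤ length l) → MaxChain x y l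
  longest-strictChain⇒maxChain {l = _ ∷ []}    c              _       = c
  longest-strictChain⇒maxChain {l = z ∷ w ∷ l} (refl , r , c) longest =
    refl , (r , no-refinement) , longest-strictChain⇒maxChain c longest-tail
    where
    no-refinement : ∀ v → ¬ (z ≺ v × v ≺ w)
    no-refinement v (z≺v , v≺w) = 1+n≰n (longest (z ∷ v ∷ w ∷ l) (refl , z≺v , refl , v≺w , c))
    longest-tail : ∀ l′ → StrictChain w _ l′ → length l′ ≤ length (w ∷ l)
    longest-tail l′ c′ with chain-head c′
    ... | r′ , refl = ≤-pred (longest (z ∷ w ∷ r′) (refl , r , c′))

  -- Neither ≼ nor ≡ on C is decidable, so a longest strict chain can only be found
  -- classically; statements about ranks are then recovered by stability of ≤ on ℕ.
  ¬¬-maxChain : ∀ {x y} → x ≼ y → DoubleNegation (∃ (MaxChain x y))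
  ¬¬-maxChain {x} {y} x≼y = do
    x≟y ← ¬¬-excluded-middle
    (_ , (l , c , refl) , longest) ←
      ¬¬-greatest HasLength (length (interval x y)) bounded (proj₂ (short x≟y))
    pure (l , longest-strictChain⇒maxChain c λ l′ c′ → longest (length l′) (l′ , c′ , refl))
    where
    HasLength : ℕ → Set
    HasLength j = ∃ λ l → StrictChain x y l × length l ≡ j
    bounded : ∀ j → HasLength j → j ≤ length (interval x y)
    bounded _ (_ , c , refl) = strictChain-length≤ c
    short : Dec (x ≡ y) → ∃ HasLength
    short (yes refl) = 1 , x ∷ [] , (refl , refl) , refl
    short (no x≢y)   = 2 , x ∷ y ∷ [] , (refl , (x≼y , x≢y) , refl , refl) , refl

  maxChain-rank : ∀ {x y l} → MaxChain x y l → ρ x + length l ≡ suc (ρ y)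
  maxChain-rank {l = z ∷ []}    (refl , refl)    = +-comm (ρ z) 1
  maxChain-rank {l = x ∷ w ∷ l} (refl , x⋖w , c) = begin
    ρ x + suc (length (w ∷ l)) ≡⟨ +-suc (ρ x) _ ⟩
    suc (ρ x) + length (w ∷ l) ≡⟨ cong (_+ length (w ∷ l)) (ρ-cover x⋖w) ⟨
    ρ w + length (w ∷ l)       ≡⟨ maxChain-rank c ⟩
    suc (ρ _)                  ∎
    where open ≡-Reasoning

  ρ-mono : ∀ {x y} → x ≼ y → ρ x ≤ ρ y
  ρ-mono {x} {y} x≼y = decidable-stable (ρ x ≤? ρ y) do
    (_ ∷ l , c) ← ¬¬-maxChain x≼y
      where ([] , ())
    pure (subst (ρ x ≤_) (suc-injective (trans (sym (+-suc (ρ x) (length l))) (maxChain-rank c)))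
                (m≤m+n (ρ x) (length l)))

  maxChain-length : ∀ {x y l} → MaxChain x y l → length l ≡ suc (ρ y ∸ ρ x)
  maxChain-length {x} {y} {l} c = +-cancelˡ-≡ (ρ x) _ _ (begin
    ρ x + length l              ≡⟨ maxChain-rank c ⟩
    suc (ρ y)                   ≡⟨ cong suc (m+[n∸m]≡n (ρ-mono (maxChain-≼ c))) ⟨
    suc (ρ x + (ρ y ∸ ρ x))     ≡⟨ +-suc (ρ x) _ ⟨
    ρ x + suc (ρ y ∸ ρ x)       ∎)
    where open ≡-Reasoning

  ρ-strict : ∀ {x y} → x ≺ y → ρ x < ρ y
  ρ-strict {x} {y} (x≼y , x≢y) = decidable-stable (suc (ρ x) ≤? ρ y) do
    (l , c) ← ¬¬-maxChain x≼y
    pure (through-cover l c)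
    where
    through-cover : ∀ l → MaxChain x y l → ρ x < ρ y
    through-cover (_ ∷ [])    (refl , refl)    = ⊥-elim (x≢y refl)
    through-cover (_ ∷ _ ∷ _) (refl , x⋖w , c) = subst (_≤ ρ y) (ρ-cover x⋖w) (ρ-mono (maxChain-≼ c))

  chain-rank : ∀ i → i ≤ ρ (chain i)
  chain-rank zero    = z≤n
  chain-rank (suc i) = ≤-trans (s≤s (chain-rank i)) (ρ-strict (chain-strict i))

  splitAtRank : ∀ k {x y c} → MaxChain x y c → k ≤ ρ y ∸ ρ x → ChainSplit _⋖_ x y k c
  splitAtRank k c k≤n = chain-split k c (subst (k <_) (sym (maxChain-length c)) (s≤s k≤n))

  split-rank : ∀ {k x y c} (s : ChainSplit _⋖_ x y k c) → ρ (ChainSplit.mid s) ∸ ρ x ≡ k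
  split-rank (split pc _ len _) = suc-injective (trans (sym (maxChain-length pc)) len)

  rankLevel : C → C → ℕ → List C
  rankLevel x y k = level (λ z → ρ z ∸ ρ x) k (interval x y)

  rank-complement : ∀ {x y z k} → x ≼ z → ρ z ∸ ρ x ≡ k → ρ y ∸ ρ z ≡ (ρ y ∸ ρ x) ∸ k
  rank-complement {x} {y} {z} {k} x≼z refl = sym (begin
    ρ y ∸ ρ x ∸ (ρ z ∸ ρ x)   ≡⟨ ∸-+-assoc (ρ y) (ρ x) _ ⟩
    ρ y ∸ (ρ x + (ρ z ∸ ρ x)) ≡⟨ cong (ρ y ∸_) (m+[n∸m]≡n (ρ-mono x≼z)) ⟩
    ρ y ∸ ρ z                 ∎)
    where open ≡-Reasoning

  chains-count : ∀ {x z k} → x ≼ z → ρ z ∸ ρ x ≡ k → HasCount (MaxChain x z) (B k)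
  chains-count x≼z refl = B-count x≼z

  -- A maximal chain of [x, y] is the same as an element z of rank level k together with
  -- maximal chains of [x, z] and of [z, y].
  module _ {x y : C} (x≼y : x ≼ y) (k : ℕ) (k≤n : k ≤ ρ y ∸ ρ x) where

    private
      n = ρ y ∸ ρ x
      levelₖ = rankLevel x y k

      levelCount : HasCount (_∈ levelₖ) (length levelₖ)
      levelCount = unique⇒hasCount (filter⁺ _ (interval-unique x y))

      elt : Fin (length levelₖ) → C
      elt = enum levelCount

      elt-∈ : ∀ j → elt j ∈ interval x y × ρ (elt j) ∸ ρ x ≡ k
      elt-∈ j = ∈-filter⁻ _ (enum-sat levelCount j)

      below : ∀ j → HasCount (MaxChain x (elt j)) (B k)
      below j = chains-count (proj₁ (interval-sound (proj₁ (elt-∈ j)))) (proj₂ (elt-∈ j))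

      above : ∀ j → HasCount (MaxChain (elt j) y) (B (n ∸ k))
      above j = chains-count (proj₂ (interval-sound (proj₁ (elt-∈ j))))
        (rank-complement (proj₁ (interval-sound (proj₁ (elt-∈ j)))) (proj₂ (elt-∈ j)))

      Triple : Set
      Triple = Fin (length levelₖ) × Fin (B k) × Fin (B (n ∸ k))

      decode : Triple → List C
      decode (j , a , b) = enum (below j) a ++ drop 1 (enum (above j) b)

      decode-sat : ∀ t → MaxChain x y (decode t)
      decode-sat (j , a , b) =
        chain-++ (enum-sat (below j) a) (subst (MaxChain _ y) (chain-uncons above-b) above-b)
        where above-b = enum-sat (above j) b

      below-length : ∀ j a → length (enum (below j) a) ≡ suc k
      below-length j a = trans (maxChain-length (enum-sat (below j) a)) (cong suc (proj₂ (elt-∈ j)))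

      decode-inj : Injective _≡_ _≡_ decode
      decode-inj {j , a , b} {j′ , a′ , b′} eq
        with ++-injective _ _ (trans (below-length j a) (sym (below-length j′ a′))) eq
      ... | prefix≡ , suffix≡
        with enum-inj levelCount (chain-last (enum-sat (below j) a)
               (subst (MaxChain x (elt j′)) (sym prefix≡) (enum-sat (below j′) a′)))
      ... | refl = cong₂ _,_ refl (cong₂ _,_ (enum-inj (below j) prefix≡) (enum-inj (above j) (begin
        enum (above j) b                      ≡⟨ chain-uncons (enum-sat (above j) b) ⟩
        elt j ∷ drop 1 (enum (above j) b)     ≡⟨ cong (elt j ∷_) suffix≡ ⟩
        elt j ∷ drop 1 (enum (above j) b′)    ≡⟨ chain-uncons (enum-sat (above j) b′) ⟨
        enum (above j) b′                     ∎)))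
        where open ≡-Reasoning

      decode-surj : ∀ c → MaxChain x y c → ∃ λ t → decode t ≡ c
      decode-surj c mc with splitAtRank k mc k≤n
      ... | s@(split pc sc _ c≡) with enum-surj levelCount _
               (∈-filter⁺ _ (interval-compl (maxChain-≼ pc) (maxChain-≼ sc)) (split-rank s))
      ... | j , refl with enum-surj (below j) _ pc | enum-surj (above j) _ sc
      ... | a , pa | b , pb = (j , a , b) , sym (trans c≡ (sym (cong₂ _++_ pa (cong (drop 1) pb))))

    rankLevel-count : length (rankLevel x y k) * (B k * B (n ∸ k)) ≡ B n
    rankLevel-count = hasCount-unique
      (hasCount-fromDecoding (↔-trans *↔× (↔-refl ×-↔ *↔×)) decode decode-inj decode-sat decode-surj)
      (B-count x≼y)

  maxChain-length-1 : ∀ {x y l} → MaxChain x y l → length l ≡ 1 → l ≡ x ∷ []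
  maxChain-length-1 {l = _ ∷ []} (refl , _) _ = refl

  maxChain-length-2 : ∀ {x y l} → MaxChain x y l → length l ≡ 2 → l ≡ x ∷ y ∷ []
  maxChain-length-2 {l = _ ∷ _ ∷ []} (refl , _ , refl , refl) _ = refl

  B-unique-chain : ∀ {x y k l} → x ≼ y → ρ y ∸ ρ x ≡ k → MaxChain x y l →
                   (∀ l′ → MaxChain x y l′ → l′ ≡ l) → B k ≡ 1
  B-unique-chain x≼y rank c unique = hasCount-unique (chains-count x≼y rank) (hasCount-singleton c unique)

-- Counting data of an n-interval [x, y] of an Eulerian binomial poset with factorial function b:
-- levelSize k is the number of elements of [x, y] of rank ρ x + k.
record EulerianProfile (b : ℕ → ℕ) (n : ℕ) : Set where
  field
    b-nonzero         : ∀ k → k ≤ n → b k ≢ 0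
    b-zero            : b 0 ≡ 1
    b-one             : b 1 ≡ 1
    levelSize         : ℕ → ℕ
    levelSize-count   : ∀ k → k ≤ n → levelSize k * (b k * b (n ∸ k)) ≡ b n
    levelSize-alternating : Σℤ (λ k → signℤ k ℤ.* + levelSize k) (suc n) ≡ + 0

module _ (P : BinomialPoset) (eulerian : Eulerian P) where

  open BinomialPoset P
  open Chains P
  open IsPartialOrder isPartialOrder using () renaming (refl to ≼-refl)

  intervalProfile : ∀ {x y n l} → MaxChain x y l → ρ y ∸ ρ x ≡ n → 1 ≤ n → EulerianProfile B n
  intervalProfile {x} {y} {n} {l} c refl 1≤n = record
    { b-nonzero             = B-nonzero
    ; b-zero                = B-unique-chain ≼-refl (n∸n≡0 (ρ x)) (refl , refl) λ l′ c′ →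
                                maxChain-length-1 c′ (trans (maxChain-length c′) (cong suc (n∸n≡0 (ρ x))))
    ; b-one                 = B-one (splitAtRank 1 c 1≤n)
    ; levelSize             = λ k → length (rankLevel x y k)
    ; levelSize-count       = rankLevel-count x≼y
    ; levelSize-alternating = alternating
    }
    where
    x≼y = maxChain-≼ c

    B-nonzero : ∀ k → k ≤ n → B k ≢ 0
    B-nonzero k k≤n Bk≡0 = hasCount-nonzero (B-count x≼y) c (begin
      B n                                          ≡⟨ rankLevel-count x≼y k k≤n ⟨
      length (rankLevel x y k) * (B k * B (n ∸ k)) ≡⟨ cong (λ b → length (rankLevel x y k) * (b * B (n ∸ k))) Bk≡0 ⟩
      length (rankLevel x y k) * 0                 ≡⟨ *-zeroʳ (length (rankLevel x y k)) ⟩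
      0                                            ∎)
      where open ≡-Reasoning

    B-one : ChainSplit _⋖_ x y 1 l → B 1 ≡ 1
    B-one s@(split pc _ len _) = B-unique-chain (maxChain-≼ pc) (split-rank s) pc λ l′ c′ →
      trans (maxChain-length-2 c′ (trans (maxChain-length c′) (cong suc (split-rank s))))
            (sym (maxChain-length-2 pc len))

    alternating : Σℤ (λ k → signℤ k ℤ.* + length (rankLevel x y k)) (suc n) ≡ + 0
    alternating = begin
      Σℤ (λ k → signℤ k ℤ.* + length (rankLevel x y k)) (suc n)
        ≡⟨ sumℤ-by-level (λ z → ρ z ∸ ρ x) signℤ (suc n) (interval x y) (All.tabulate rank<) ⟨
      sumℤ (map (λ z → signℤ (ρ z ∸ ρ x)) (interval x y))
        ≡⟨ cong sumℤ (map-cong-local (All.tabulate (λ z∈ → sym (μ-sign x _ (proj₁ (interval-sound z∈)))))) ⟩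
      sumℤ (map (μ x) (interval x y))
        ≡⟨ proj₂ μ-isMobius x y (x≼y , x≢y) ⟩
      + 0 ∎
      where
      open ≡-Reasoning
      μ = proj₁ eulerian
      μ-isMobius = proj₁ (proj₂ eulerian)
      μ-sign = proj₂ (proj₂ eulerian)
      rank< : ∀ {z} → z ∈ interval x y → ρ z ∸ ρ x < suc n
      rank< z∈ = s≤s (∸-monoˡ-≤ (ρ x) (ρ-mono (proj₂ (interval-sound z∈))))
      x≢y : x ≢ y
      x≢y refl = <-irrefl (sym (n∸n≡0 (ρ x))) 1≤n

  ¬¬-eulerianProfile : ∀ n → 1 ≤ n → DoubleNegation (EulerianProfile B n)
  ¬¬-eulerianProfile n 1≤n = do
    (l , c) ← ¬¬-maxChain (bot-min (chain n))
    let s@(split pc _ _ _) = splitAtRank n c (subst (λ r → n ≤ ρ (chain n) ∸ r) (sym ρ-bot) (chain-rank n))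
    pure (intervalProfile pc (split-rank s) 1≤n)

-- Rational arithmetic

ιℤ : ℤ → ℚ
ιℤ z = z ℚ./ 1

ι : ℕ → ℚ
ι a = ιℤ (+ a)

-- ιℤ z is definitionally fromℚᵘ (mkℚᵘ z 0), so its arithmetic is transported from ℚᵘ.
toℚᵘ-ιℤ : ∀ z → ℚ.toℚᵘ (ιℤ z) ℚᵘ.≃ ℚᵘ.mkℚᵘ z 0
toℚᵘ-ιℤ z = ℚ.toℚᵘ-fromℚᵘ (ℚᵘ.mkℚᵘ z 0)

ιℤ-+ : ∀ a c → ιℤ (a ℤ.+ c) ≡ ιℤ a ℚ.+ ιℤ c
ιℤ-+ a c = ℚ.toℚᵘ-injective (ℚᵘ.≃-trans (toℚᵘ-ιℤ (a ℤ.+ c)) (ℚᵘ.≃-sym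
  (ℚᵘ.≃-trans (ℚ.toℚᵘ-homo-+ (ιℤ a) (ιℤ c))
              (ℚᵘ.≃-trans (ℚᵘ.+-cong (toℚᵘ-ιℤ a) (toℚᵘ-ιℤ c)) (ℚᵘ.*≡* cross)))))
  where
  cross : (a ℤ.* + 1 ℤ.+ c ℤ.* + 1) ℤ.* + 1 ≡ (a ℤ.+ c) ℤ.* (+ 1 ℤ.* + 1)
  cross rewrite ℤ.*-identityʳ a | ℤ.*-identityʳ c | ℤ.*-identityʳ (a ℤ.+ c) = refl

ιℤ-* : ∀ a c → ιℤ (a ℤ.* c) ≡ ιℤ a ℚ.* ιℤ c
ιℤ-* a c = ℚ.toℚᵘ-injective (ℚᵘ.≃-trans (toℚᵘ-ιℤ (a ℤ.* c)) (ℚᵘ.≃-sym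
  (ℚᵘ.≃-trans (ℚ.toℚᵘ-homo-* (ιℤ a) (ιℤ c))
              (ℚᵘ.≃-trans (ℚᵘ.*-cong (toℚᵘ-ιℤ a) (toℚᵘ-ιℤ c)) (ℚᵘ.*≡* refl)))))

ιℤ-injective : ∀ a c → ιℤ a ≡ ιℤ c → a ≡ c
ιℤ-injective a c eq
  with ℚᵘ.≃-trans (ℚᵘ.≃-sym (toℚᵘ-ιℤ a)) (ℚᵘ.≃-trans (ℚ.toℚᵘ-cong eq) (toℚᵘ-ιℤ c))
... | ℚᵘ.*≡* cross = trans (sym (ℤ.*-identityʳ a)) (trans cross (ℤ.*-identityʳ c))

ι-* : ∀ a c → ι (a * c) ≡ ι a ℚ.* ι c
ι-* a c = trans (cong ιℤ (ℤ.pos-* a c)) (ιℤ-* (+ a) (+ c))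

ι-injective : ∀ a c → ι a ≡ ι c → a ≡ c
ι-injective a c eq = ℤ.+-injective (ιℤ-injective (+ a) (+ c) eq)

ι-nonzero : ∀ {a} → a ≢ 0 → ι a ≢ 0ℚ
ι-nonzero a≢0 eq = a≢0 (ι-injective _ 0 eq)

divℚ-cancelʳ : ∀ p {q} → q ≢ 0ℚ → divℚ p q ℚ.* q ≡ p
divℚ-cancelʳ p {q} q≢0 with q ℚ.≟ 0ℚ
... | yes q≡0 = ⊥-elim (q≢0 q≡0)
... | no  q≢0 = trans (ℚ.*-assoc p _ q)
  (trans (cong (p ℚ.*_) (ℚ.*-inverseˡ q {{ℚ.≢-nonZero q≢0}})) (ℚ.*-identityʳ p))

divℚ-unique : ∀ {x p q} → q ≢ 0ℚ → x ℚ.* q ≡ p → divℚ p q ≡ x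
divℚ-unique {x} {p} {q} q≢0 xq≡p with q ℚ.≟ 0ℚ
... | yes q≡0 = ⊥-elim (q≢0 q≡0)
... | no  q≢0 = begin
  p ℚ.÷ q                 ≡⟨ cong (ℚ._÷ q) xq≡p ⟨
  x ℚ.* q ℚ.* ℚ.1/ q      ≡⟨ ℚ.*-assoc x q _ ⟩
  x ℚ.* (q ℚ.* ℚ.1/ q)    ≡⟨ cong (x ℚ.*_) (ℚ.*-inverseʳ q) ⟩
  x ℚ.* 1ℚ                ≡⟨ ℚ.*-identityʳ x ⟩
  x                       ∎
  where
  open ≡-Reasoning
  instance _ = ℚ.≢-nonZero q≢0

divℚ-1-unique : ∀ {x q} → x ℚ.* q ≡ 1ℚ → divℚ 1ℚ q ≡ x
divℚ-1-unique {x} xq≡1 = divℚ-unique (λ { refl → case (trans (sym (ℚ.*-zeroʳ x)) xq≡1) of λ () }) xq≡1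

*-zero-cancelˡ : ∀ {c y} → c ≢ 0ℚ → c ℚ.* y ≡ 0ℚ → y ≡ 0ℚ
*-zero-cancelˡ {c} {y} c≢0 cy≡0 =
  trans (sym (divℚ-unique c≢0 (trans (ℚ.*-comm y c) cy≡0))) (divℚ-unique c≢0 (ℚ.*-zeroˡ c))

Σℚ : (ℕ → ℚ) → ℕ → ℚ
Σℚ h zero    = 0ℚ
Σℚ h (suc N) = Σℚ h N ℚ.+ h N

Σℚ-cong : ∀ {h h′} N → (∀ k → k < N → h k ≡ h′ k) → Σℚ h N ≡ Σℚ h′ N
Σℚ-cong zero    _  = refl
Σℚ-cong (suc N) eq = cong₂ ℚ._+_ (Σℚ-cong N λ k k<N → eq k (m≤n⇒m≤1+n k<N)) (eq N ≤-refl)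

Σℚ-ιℤ : ∀ h N → Σℚ (ιℤ ∘ h) N ≡ ιℤ (Σℤ h N)
Σℚ-ιℤ h zero    = refl
Σℚ-ιℤ h (suc N) = trans (cong (ℚ._+ ιℤ (h N)) (Σℚ-ιℤ h N)) (sym (ιℤ-+ (Σℤ h N) (h N)))

Σℚ-*ˡ : ∀ c h N → Σℚ (λ k → c ℚ.* h k) N ≡ c ℚ.* Σℚ h N
Σℚ-*ˡ c h zero    = sym (ℚ.*-zeroʳ c)
Σℚ-*ˡ c h (suc N) = trans (cong (ℚ._+ c ℚ.* h N) (Σℚ-*ˡ c h N)) (sym (ℚ.*-distribˡ-+ c (Σℚ h N) (h N)))

Σℚ-peel : ∀ h N → Σℚ h (suc N) ≡ h 0 ℚ.+ Σℚ (h ∘ suc) N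
Σℚ-peel h zero    = trans (ℚ.+-identityˡ (h 0)) (sym (ℚ.+-identityʳ (h 0)))
Σℚ-peel h (suc N) = trans (cong (ℚ._+ h (suc N)) (Σℚ-peel h N)) (ℚ.+-assoc (h 0) _ _)

module _ (b : ℕ → ℕ) where

  recip : ℕ → ℚ
  recip k = divℚ 1ℚ (ι (b k))

  recip-inverse : ∀ {k} → b k ≢ 0 → recip k ℚ.* ι (b k) ≡ 1ℚ
  recip-inverse bk≢0 = divℚ-cancelʳ 1ℚ (ι-nonzero bk≢0)

  recip-one : ∀ {k} → b k ≡ 1 → recip k ≡ 1ℚ
  recip-one {k} bk≡1 = divℚ-1-unique {q = ι (b k)} (cong (λ a → 1ℚ ℚ.* ι a) bk≡1)

  -- atom P and quantity P are atomOf (B P) and quantityOf (B P) by definition.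
  atomOf : ℕ → ℚ
  atomOf n = divℚ (ι (b n)) (ι (b (n ∸ 1)))

  quantityOf : ℕ → ℚ
  quantityOf m = divℚ 1ℚ (atomOf (suc (2 * m))) ℚ.* (1ℚ - divℚ 1ℚ (atomOf (suc (suc (2 * m)))))

  atomOf-recip : ∀ {k} → b k ≢ 0 → atomOf (suc k) ≡ ι (b (suc k)) ℚ.* recip k
  atomOf-recip {k} bk≢0 = divℚ-unique (ι-nonzero bk≢0) (begin
    ι (b (suc k)) ℚ.* recip k ℚ.* ι (b k)   ≡⟨ ℚ.*-assoc (ι (b (suc k))) _ _ ⟩
    ι (b (suc k)) ℚ.* (recip k ℚ.* ι (b k)) ≡⟨ cong (ι (b (suc k)) ℚ.*_) (recip-inverse bk≢0) ⟩
    ι (b (suc k)) ℚ.* 1ℚ                    ≡⟨ ℚ.*-identityʳ _ ⟩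
    ι (b (suc k))                           ∎)
    where open ≡-Reasoning

  inverse-atomOf : ∀ {k} → b k ≢ 0 → b (suc k) ≢ 0 → divℚ 1ℚ (atomOf (suc k)) ≡ ι (b k) ℚ.* recip (suc k)
  inverse-atomOf {k} bk≢0 b1+k≢0 = divℚ-1-unique (begin
    ι (b k) ℚ.* recip (suc k) ℚ.* atomOf (suc k)
      ≡⟨ cong (ι (b k) ℚ.* recip (suc k) ℚ.*_) (atomOf-recip bk≢0) ⟩
    ι (b k) ℚ.* recip (suc k) ℚ.* (ι (b (suc k)) ℚ.* recip k)
      ≡⟨ solve 4 (λ a r a′ r′ → (a :* r′) :* (a′ :* r) := (r :* a) :* (r′ :* a′)) refl
           (ι (b k)) (recip k) (ι (b (suc k))) (recip (suc k)) ⟩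
    recip k ℚ.* ι (b k) ℚ.* (recip (suc k) ℚ.* ι (b (suc k)))
      ≡⟨ cong₂ ℚ._*_ (recip-inverse bk≢0) (recip-inverse b1+k≢0) ⟩
    1ℚ ∎)
    where open ≡-Reasoning

  quantityOf-recip : ∀ m → (∀ k → k ≤ suc (suc (2 * m)) → b k ≢ 0) →
    quantityOf m ≡ ι (b (2 * m)) ℚ.* (recip (suc (2 * m)) - recip (suc (suc (2 * m))))
  quantityOf-recip m b≢0 = begin
    quantityOf m
      ≡⟨ cong₂ (λ u v → u ℚ.* (1ℚ - v)) (inverse-atomOf (b≢0 M M≤) (b≢0 (1 + M) (n≤1+n _)))
                                        (inverse-atomOf (b≢0 (1 + M) (n≤1+n _)) (b≢0 (2 + M) ≤-refl)) ⟩
    ι (b M) ℚ.* recip (1 + M) ℚ.* (1ℚ - ι (b (1 + M)) ℚ.* recip (2 + M))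
      ≡⟨ solve 4 (λ a r a′ r′ → (a :* r) :* (con 1ℚ :- a′ :* r′) := a :* (r :- (r :* a′) :* r′)) refl
           (ι (b M)) (recip (1 + M)) (ι (b (1 + M))) (recip (2 + M)) ⟩
    ι (b M) ℚ.* (recip (1 + M) - recip (1 + M) ℚ.* ι (b (1 + M)) ℚ.* recip (2 + M))
      ≡⟨ cong (λ u → ι (b M) ℚ.* (recip (1 + M) - u ℚ.* recip (2 + M)))
              (recip-inverse (b≢0 (1 + M) (n≤1+n _))) ⟩
    ι (b M) ℚ.* (recip (1 + M) - 1ℚ ℚ.* recip (2 + M))
      ≡⟨ cong (λ u → ι (b M) ℚ.* (recip (1 + M) - u)) (ℚ.*-identityˡ _) ⟩
    ι (b M) ℚ.* (recip (1 + M) - recip (2 + M)) ∎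
    where
    open ≡-Reasoning
    M = 2 * m
    M≤ : M ≤ 2 + M
    M≤ = ≤-trans (n≤1+n M) (n≤1+n (1 + M))

module _ {b : ℕ → ℕ} {n : ℕ} (profile : EulerianProfile b n) where

  open EulerianProfile profile

  levelSize-recip : ∀ k → k ≤ n → ι (levelSize k) ≡ ι (b n) ℚ.* (recip b k ℚ.* recip b (n ∸ k))
  levelSize-recip k k≤n = sym (begin
    ι (b n) ℚ.* (r k ℚ.* r (n ∸ k))
      ≡⟨ cong (ℚ._* (r k ℚ.* r (n ∸ k))) count ⟨
    ι (levelSize k) ℚ.* (ι (b k) ℚ.* ι (b (n ∸ k))) ℚ.* (r k ℚ.* r (n ∸ k))
      ≡⟨ solve 5 (λ N a a′ q q′ → (N :* (a :* a′)) :* (q :* q′) := N :* ((q :* a) :* (q′ :* a′))) refl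
           (ι (levelSize k)) (ι (b k)) (ι (b (n ∸ k))) (r k) (r (n ∸ k)) ⟩
    ι (levelSize k) ℚ.* (r k ℚ.* ι (b k) ℚ.* (r (n ∸ k) ℚ.* ι (b (n ∸ k))))
      ≡⟨ cong₂ (λ u v → ι (levelSize k) ℚ.* (u ℚ.* v))
           (recip-inverse b (b-nonzero k k≤n)) (recip-inverse b (b-nonzero (n ∸ k) (m∸n≤m n k))) ⟩
    ι (levelSize k) ℚ.* (1ℚ ℚ.* 1ℚ)
      ≡⟨ ℚ.*-identityʳ _ ⟩
    ι (levelSize k) ∎)
    where
    open ≡-Reasoning
    r = recip b
    count : ι (levelSize k) ℚ.* (ι (b k) ℚ.* ι (b (n ∸ k))) ≡ ι (b n)
    count = trans (cong (ι (levelSize k) ℚ.*_) (sym (ι-* (b k) _)))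
                  (trans (sym (ι-* (levelSize k) _)) (cong ι (levelSize-count k k≤n)))

  alternating-recip-sum : Σℚ (λ k → ιℤ (signℤ k) ℚ.* (recip b k ℚ.* recip b (n ∸ k))) (suc n) ≡ 0ℚ
  alternating-recip-sum = *-zero-cancelˡ (ι-nonzero (b-nonzero n ≤-refl)) (begin
    ι (b n) ℚ.* Σℚ F (suc n)                                 ≡⟨ Σℚ-*ˡ (ι (b n)) F (suc n) ⟨
    Σℚ (λ k → ι (b n) ℚ.* F k) (suc n)                       ≡⟨ Σℚ-cong (suc n) scaled ⟩
    Σℚ (λ k → ιℤ (signℤ k ℤ.* + levelSize k)) (suc n)        ≡⟨ Σℚ-ιℤ _ (suc n) ⟩
    ιℤ (Σℤ (λ k → signℤ k ℤ.* + levelSize k) (suc n))        ≡⟨ cong ιℤ levelSize-alternating ⟩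
    0ℚ                                                       ∎)
    where
    open ≡-Reasoning
    F : ℕ → ℚ
    F k = ιℤ (signℤ k) ℚ.* (recip b k ℚ.* recip b (n ∸ k))
    scaled : ∀ k → k < suc n → ι (b n) ℚ.* F k ≡ ιℤ (signℤ k ℤ.* + levelSize k)
    scaled k k<1+n = begin
      ι (b n) ℚ.* (ιℤ (signℤ k) ℚ.* (recip b k ℚ.* recip b (n ∸ k)))
        ≡⟨ solve 3 (λ a s q → a :* (s :* q) := s :* (a :* q)) refl (ι (b n)) (ιℤ (signℤ k)) _ ⟩
      ιℤ (signℤ k) ℚ.* (ι (b n) ℚ.* (recip b k ℚ.* recip b (n ∸ k)))
        ≡⟨ cong (ιℤ (signℤ k) ℚ.*_) (levelSize-recip k (≤-pred k<1+n)) ⟨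
      ιℤ (signℤ k) ℚ.* ι (levelSize k)
        ≡⟨ ιℤ-* (signℤ k) _ ⟨
      ιℤ (signℤ k ℤ.* + levelSize k) ∎

recipGap : (ℕ → ℕ) → ℕ → ℚ
recipGap b t = recip b (2 + t) - recip b (3 + t)

middleSum : (ℕ → ℕ) → ℕ → ℚ
middleSum b t = Σℚ (λ i → ιℤ (signℤ (2 + i)) ℚ.* (recip b (2 + i) ℚ.* recip b (suc t ∸ i))) t

-- For even n = 3 + t the two outermost terms at each end of the alternating reciprocal sum
-- are recip b n and - recip b (n - 1), since b 0 = b 1 = 1.
recip-gap-twice : ∀ {b t} → EulerianProfile b (3 + t) → signℤ (suc t) ≡ + 1 →
                  recipGap b t ℚ.+ recipGap b t ≡ middleSum b t
recip-gap-twice {b} {t} profile even = begin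
  D ℚ.+ D
    ≡⟨ solve 3 (λ r r′ T → (r :- r′) :+ (r :- r′) := T :- (((r′ :+ (:- r :+ T)) :+ :- r) :+ r′)) refl
         (r (2 + t)) (r n) T ⟩
  T - (((r n ℚ.+ (- r (2 + t) ℚ.+ T)) ℚ.+ - r (2 + t)) ℚ.+ r n)
    ≡⟨ cong (λ s → T - s) outer-terms ⟨
  T - Σℚ F (suc n)
    ≡⟨ cong (λ s → T - s) (alternating-recip-sum profile) ⟩
  T - 0ℚ
    ≡⟨ solve 1 (λ x → x :- con 0ℚ := x) refl T ⟩
  T ∎
  where
  open ≡-Reasoning
  open EulerianProfile profile using (b-zero; b-one)
  n = 3 + t
  r = recip b
  D = recipGap b t
  T = middleSum b t
  F : ℕ → ℚ
  F k = ιℤ (signℤ k) ℚ.* (r k ℚ.* r (n ∸ k))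

  minus : ∀ x → ιℤ (ℤ.- + 1) ℚ.* x ≡ - x
  minus = solve 1 (λ x → con (- 1ℚ) :* x := :- x) refl

  F-first : F 0 ≡ r n
  F-first = trans (cong (λ u → ιℤ (+ 1) ℚ.* (u ℚ.* r n)) (recip-one b b-zero))
                  (trans (ℚ.*-identityˡ (1ℚ ℚ.* r n)) (ℚ.*-identityˡ (r n)))
  F-second : F 1 ≡ - r (2 + t)
  F-second = trans (cong (λ u → ιℤ (ℤ.- + 1) ℚ.* (u ℚ.* r (2 + t))) (recip-one b b-one))
                   (trans (cong (ιℤ (ℤ.- + 1) ℚ.*_) (ℚ.*-identityˡ (r (2 + t)))) (minus (r (2 + t))))
  F-penultimate : F (2 + t) ≡ - r (2 + t)
  F-penultimate = trans (cong₂ (λ s k → ιℤ (ℤ.- s) ℚ.* (r (2 + t) ℚ.* r k)) even (m+n∸n≡m 1 (2 + t)))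
    (trans (cong (λ u → ιℤ (ℤ.- + 1) ℚ.* (r (2 + t) ℚ.* u)) (recip-one b b-one))
           (trans (cong (ιℤ (ℤ.- + 1) ℚ.*_) (ℚ.*-identityʳ (r (2 + t)))) (minus (r (2 + t)))))
  F-last : F n ≡ r n
  F-last = trans (cong₂ (λ s k → ιℤ (ℤ.- (ℤ.- s)) ℚ.* (r n ℚ.* r k)) even (n∸n≡0 n))
    (trans (cong (λ u → ιℤ (+ 1) ℚ.* (r n ℚ.* u)) (recip-one b b-zero))
           (trans (ℚ.*-identityˡ (r n ℚ.* 1ℚ)) (ℚ.*-identityʳ (r n))))

  outer-terms : Σℚ F (suc n) ≡ ((r n ℚ.+ (- r (2 + t) ℚ.+ T)) ℚ.+ - r (2 + t)) ℚ.+ r n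
  outer-terms = begin
    Σℚ F (suc n)
      ≡⟨ cong (λ s → s ℚ.+ F (2 + t) ℚ.+ F n)
              (trans (Σℚ-peel F (suc t)) (cong (F 0 ℚ.+_) (Σℚ-peel (F ∘ suc) t))) ⟩
    ((F 0 ℚ.+ (F 1 ℚ.+ T)) ℚ.+ F (2 + t)) ℚ.+ F n
      ≡⟨ cong₂ ℚ._+_ (cong₂ ℚ._+_ (cong₂ ℚ._+_ F-first (cong (ℚ._+ T) F-second)) F-penultimate) F-last ⟩
    ((r n ℚ.+ (- r (2 + t) ℚ.+ T)) ℚ.+ - r (2 + t)) ℚ.+ r n ∎

double-injective : ∀ {x y} → x ℚ.+ x ≡ y ℚ.+ y → x ≡ y
double-injective {x} {y} eq = trans (solve 1 (λ x → x := (x :+ x) :* con ℚ.½) refl x)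
  (trans (cong (ℚ._* ℚ.½) eq) (solve 1 (λ y → (y :+ y) :* con ℚ.½ := y) refl y))

signℤ-even : ∀ m → signℤ (2 * m) ≡ + 1
signℤ-even zero    = refl
signℤ-even (suc m) = trans (cong signℤ (*-suc 2 m)) (trans (ℤ.neg-involutive (signℤ (2 * m))) (signℤ-even m))

quantityOf-determined : ∀ {b b′} m → 1 ≤ m →
  EulerianProfile b (2 + 2 * m) → EulerianProfile b′ (2 + 2 * m) →
  (∀ k → k ≤ 2 * m → b k ≡ b′ k) → quantityOf b m ≡ quantityOf b′ m
quantityOf-determined {b} {b′} m@(suc _) (s≤s _) profile profile′ agree = begin
  quantityOf b m
    ≡⟨ quantityOf-recip b m (b-nonzero profile) ⟩
  ι (b (2 * m)) ℚ.* (recip b (1 + 2 * m) - recip b (2 + 2 * m))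
    ≡⟨ cong₂ ℚ._*_ (cong ι (agree (2 * m) ≤-refl)) gaps-agree ⟩
  ι (b′ (2 * m)) ℚ.* (recip b′ (1 + 2 * m) - recip b′ (2 + 2 * m))
    ≡⟨ quantityOf-recip b′ m (b-nonzero profile′) ⟨
  quantityOf b′ m ∎
  where
  open ≡-Reasoning
  open EulerianProfile using (b-nonzero)
  gaps-agree : recip b (1 + 2 * m) - recip b (2 + 2 * m) ≡ recip b′ (1 + 2 * m) - recip b′ (2 + 2 * m)
  gaps-agree = double-injective (trans (recip-gap-twice profile (signℤ-even m))
    (trans (Σℚ-cong _ λ i i<t →
              cong₂ (λ u v → ιℤ (signℤ (2 + i)) ℚ.* (divℚ 1ℚ (ι u) ℚ.* divℚ 1ℚ (ι v)))
                    (agree (2 + i) (s≤s i<t)) (agree _ (m∸n≤m _ i)))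
           (sym (recip-gap-twice profile′ (signℤ-even m)))))

atomOf-determines : ∀ {b b′} M → b 0 ≡ 1 → b′ 0 ≡ 1 →
  (∀ k → k ≤ M → b k ≢ 0) → (∀ k → k ≤ M → b′ k ≢ 0) →
  (∀ n → 1 ≤ n → n ≤ M → atomOf b n ≡ atomOf b′ n) → ∀ k → k ≤ M → b k ≡ b′ k
atomOf-determines M b0≡1 b′0≡1 b≢0 b′≢0 atoms zero    _     = trans b0≡1 (sym b′0≡1)
atomOf-determines {b} {b′} M b0≡1 b′0≡1 b≢0 b′≢0 atoms (suc k) 1+k≤M = ι-injective _ _ (begin
  ι (b (suc k))                      ≡⟨ divℚ-cancelʳ _ (ι-nonzero (b≢0 k k≤M)) ⟨
  atomOf b (suc k) ℚ.* ι (b k)       ≡⟨ cong₂ ℚ._*_ (atoms (suc k) (s≤s z≤n) 1+k≤M) (cong ι previous) ⟩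
  atomOf b′ (suc k) ℚ.* ι (b′ k)     ≡⟨ divℚ-cancelʳ _ (ι-nonzero (b′≢0 k k≤M)) ⟩
  ι (b′ (suc k))                     ∎)
  where
  open ≡-Reasoning
  k≤M = ≤-trans (n≤1+n k) 1+k≤M
  previous = atomOf-determines M b0≡1 b′0≡1 b≢0 b′≢0 atoms k k≤M

lemma2p12 : (P P′ : BinomialPoset) → Eulerian P → Eulerian P′
    → (m : ℕ) → 2 ≤ m
    → (∀ n → 1 ≤ n → n ≤ 2 * m → atom P n ≡ atom P′ n)
    → quantity P m ≡ quantity P′ m
lemma2p12 P P′ eulerian eulerian′ m 2≤m atoms-agree =
  decidable-stable (quantity P m ℚ.≟ quantity P′ m) do
    profile  ← ¬¬-eulerianProfile P eulerian (2 + 2 * m) (s≤s z≤n)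
    profile′ ← ¬¬-eulerianProfile P′ eulerian′ (2 + 2 * m) (s≤s z≤n)
    let open EulerianProfile
        below-2m : ∀ {k} → k ≤ 2 * m → k ≤ 2 + 2 * m
        below-2m k≤ = ≤-trans k≤ (m≤n+m (2 * m) 2)
    pure (quantityOf-determined m (≤-trans (s≤s z≤n) 2≤m) profile profile′
      (atomOf-determines (2 * m) (b-zero profile) (b-zero profile′)
        (λ k → b-nonzero profile k ∘ below-2m) (λ k → b-nonzero profile′ k ∘ below-2m) atoms-agree))
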